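{- The conditional logics $\mathsf{CKCEM}$ and $\mathsf{CKCEMID}$ do not have the uniform Lyndon interpolation property.
   Context: $\mathcal{L}_{\triangleright}$: formulas from atoms and $\bot$ with $\wedge,\vee,\to$ and binary $\triangleright$; $\top:=\bot\to\bot$, $\neg A:=A\to\bot$. A logic is a set of formulas containing all classical tautologies, closed under substitution and modus ponens. $\mathsf{CE}$: smallest set of formulas containing classical tautologies, closed under modus ponens and the rule from $\phi_0\leftrightarrow\phi_1$ and $\psi_0\leftrightarrow\psi_1$ infer $(\phi_0\triangleright\psi_0)\to(\phi_1\triangleright\psi_1)$. Axioms: (CM) $(\phi\triangleright\psi\wedge\theta)\to(\phi\triangleright\psi)\wedge(\phi\triangleright\theta)$; (CC) $(\phi\triangleright\psi)\wedge(\phi\triangleright\theta)\to(\phi\triangleright\psi\wedge\theta)$; (CN) $\phi\triangleright\top$; (CEM) $(\phi\triangleright\psi)\vee(\phi\triangleright\neg\psi)$; (ID) $\phi\triangleright\phi$. $\mathsf{CKCEM}=\mathsf{CE}+(CM)+(CC)+(CN)+(CEM)$ and $\mathsf{CKCEMID}=\mathsf{CKCEM}+(ID)$ (adding all instances and closing under the rules). Polarity: $V^+(p)=\{p\}$, $V^-(p)=\varnothing$, $V^{\pm}(\bot)=\varnothing$, $V^{\pm}$ distributes over $\wedge,\vee$, $V^+(\phi\to\psi)=V^-(\phi)\cup V^+(\psi)$, $V^-(\phi\to\psi)=V^+(\phi)\cup V^-(\psi)$, $V^+(\phi\triangleright\psi)=V^-(\phi)\cup V^+(\psi)$, $V^-(\phi\triangleright\psi)=V^+(\phi)\cup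 V^-(\psi)$; $\phi$ is $p^{\circ}$-free if $p\notin V^{\circ}(\phi)$. Uniform Lyndon interpolation property of a logic $L$: for every formula $\phi$, atom $p$ and $\circ\in\{+,-\}$ there are $p^{\circ}$-free formulas $\forall^{\circ}p\,\phi,\exists^{\circ}p\,\phi$ with $V^{\dagger}(\forall^{\circ}p\,\phi),V^{\dagger}(\exists^{\circ}p\,\phi)\subseteq V^{\dagger}(\phi)$ for both $\dagger\in\{+,-\}$, such that $L\vdash\forall^{\circ}p\,\phi\to\phi$; for every $p^{\circ}$-free $\psi$, $L\vdash\psi\to\phi$ implies $L\vdash\psi\to\forall^{\circ}p\,\phi$; $L\vdash\phi\to\exists^{\circ}p\,\phi$; and for every $p^{\circ}$-free $\psi$, $L\vdash\phi\to\psi$ implies $L\vdash\exists^{\circ}p\,\phi\to\psi$. -}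

module Defs where

open import Data.Nat using (ℕ)
open import Data.Bool using (Bool; true; false; _∧_; _∨_; not)
open import Data.Empty using () renaming (⊥ to Empty)
open import Data.Sum using (_⊎_)
open import Data.Product using (Σ; _×_)
open import Relation.Nullary using (¬_)
open import Relation.Binary.PropositionalEquality using (_≡_)

infixr 6 _⋀_
infixr 5 _⋁_
infixr 4 _⇒_
infix 7 _▷_

data Fm : Set where
  atom : ℕ → Fm
  ⊥'   : Fm
  _⋀_  : Fm → Fm → Fm
  _⋁_  : Fm → Fm → Fm
  _⇒_  : Fm → Fm → Fm
  _▷_  : Fm → Fm → Fm

⊤' : Fm
⊤' = ⊥' ⇒ ⊥'

¬' : Fm → Fm
¬' A = A ⇒ ⊥'

_⇔_ : Fm → Fm → Fm
A ⇔ B = (A ⇒ B) ⋀ (B ⇒ A)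

eval : (Fm → Bool) → Fm → Bool
eval v (atom p) = v (atom p)
eval v ⊥'       = false
eval v (A ⋀ B)  = eval v A ∧ eval v B
eval v (A ⋁ B)  = eval v A ∨ eval v B
eval v (A ⇒ B)  = not (eval v A) ∨ eval v B
eval v (A ▷ B)  = v (A ▷ B)

Taut : Fm → Set
Taut A = ∀ (v : Fm → Bool) → eval v A ≡ true

data Deriv (withID : Bool) : Fm → Set where
  taut : ∀ {A} → Taut A → Deriv withID A
  mp   : ∀ {A B} → Deriv withID (A ⇒ B) → Deriv withID A → Deriv withID B
  re   : ∀ {φ₀ φ₁ ψ₀ ψ₁} → Deriv withID (φ₀ ⇔ φ₁) → Deriv withID (ψ₀ ⇔ ψ₁)
       → Deriv withID ((φ₀ ▷ ψ₀) ⇒ (φ₁ ▷ ψ₁))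
  axCM  : ∀ φ ψ θ → Deriv withID ((φ ▷ (ψ ⋀ θ)) ⇒ ((φ ▷ ψ) ⋀ (φ ▷ θ)))
  axCC  : ∀ φ ψ θ → Deriv withID (((φ ▷ ψ) ⋀ (φ ▷ θ)) ⇒ (φ ▷ (ψ ⋀ θ)))
  axCN  : ∀ φ → Deriv withID (φ ▷ ⊤')
  axCEM : ∀ φ ψ → Deriv withID ((φ ▷ ψ) ⋁ (φ ▷ ¬' ψ))
  axID  : withID ≡ true → ∀ φ → Deriv withID (φ ▷ φ)

CKCEM : Fm → Set
CKCEM = Deriv false

CKCEMID : Fm → Set
CKCEMID = Deriv true

data Pol : Set where
  pos neg : Pol

flip : Pol → Pol
flip pos = neg
flip neg = pos

Occ : Pol → ℕ → Fm → Set
Occ pos p (atom q) = p ≡ q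
Occ neg p (atom q) = Empty
Occ s p ⊥'       = Empty
Occ s p (A ⋀ B)  = Occ s p A ⊎ Occ s p B
Occ s p (A ⋁ B)  = Occ s p A ⊎ Occ s p B
Occ s p (A ⇒ B)  = Occ (flip s) p A ⊎ Occ s p B
Occ s p (A ▷ B)  = Occ (flip s) p A ⊎ Occ s p B

Free : Pol → ℕ → Fm → Set
Free s p A = ¬ Occ s p A

VarsSub : Fm → Fm → Set
VarsSub B A = ∀ (t : Pol) (q : ℕ) → Occ t q B → Occ t q A

ULIP : (Fm → Set) → Set
ULIP L =
  ∀ (φ : Fm) (p : ℕ) (s : Pol) →
  Σ Fm λ Aφ → Σ Fm λ Eφ →
    (Free s p Aφ × Free s p Eφ × VarsSub Aφ φ × VarsSub Eφ φ
    × L (Aφ ⇒ φ)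
    × (∀ ψ → Free s p ψ → L (ψ ⇒ φ) → L (ψ ⇒ Aφ))
    × L (φ ⇒ Eφ)
    × (∀ ψ → Free s p ψ → L (φ ⇒ ψ) → L (Eφ ⇒ ψ)))

-- Take φ = p ▷ q and the p⁻-free ψ = ¬(p ▷ ¬q); by CEM, ψ → φ is a theorem, so ψ → ∀⁻p φ must be
-- one too. Since p occurs in φ only negatively, ∀⁻p φ cannot contain p at all. In a three-world
-- selection-function model where q holds exactly at a and b and p exactly at a and c, a p-free
-- formula cannot distinguish a from b, so its conditionals never have the antecedent {a, c} = ⟦p⟧
-- and are true everywhere; hence p-free formulas cannot see which world is selected for ⟦p⟧.
-- Selecting a makes ψ, and so ∀⁻p φ, true at a; selecting c then makes φ false at a while
-- ∀⁻p φ stays true, refuting ∀⁻p φ → φ.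
module Submission where

open import Defs
open import Data.Bool using (Bool; true; false; _∧_; _∨_; not)
open import Data.Bool.Properties using (∨-inverseˡ)
open import Data.Empty using (⊥; ⊥-elim)
open import Data.Maybe using (Maybe; just; nothing; maybe′)
open import Data.Maybe.Properties using (just-injective)
open import Data.Nat using (ℕ; zero; suc)
open import Data.Product using (_×_; _,_)
open import Data.Sum using (_⊎_; inj₁; inj₂)
import Data.Sum as Sum
open import Function using (_∘_)
open import Relation.Binary.PropositionalEquality
  using (_≡_; _≢_; refl; sym; trans; cong; cong₂)
open import Relation.Nullary using (¬_)

-- Functional selection models: at most one world is selected, and when none is, every
-- conditional with that antecedent holds.
record Model : Set₁ where
  field
    World   : Set
    val     : ℕ → World → Bool
    sel     : World → (World → Bool) → Maybe World
    sel-ext : ∀ w {X Y : World → Bool} → (∀ x → X x ≡ Y x) → sel w X ≡ sel w Y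

open Model

⟦_⟧ : Fm → (M : Model) → World M → Bool
⟦ atom p ⟧ M w = val M p w
⟦ ⊥' ⟧     M w = false
⟦ A ⋀ B ⟧  M w = ⟦ A ⟧ M w ∧ ⟦ B ⟧ M w
⟦ A ⋁ B ⟧  M w = ⟦ A ⟧ M w ∨ ⟦ B ⟧ M w
⟦ A ⇒ B ⟧  M w = not (⟦ A ⟧ M w) ∨ ⟦ B ⟧ M w
⟦ A ▷ B ⟧  M w = maybe′ (⟦ B ⟧ M) true (sel M w (⟦ A ⟧ M))

Valid : Model → Fm → Set
Valid M A = ∀ w → ⟦ A ⟧ M w ≡ true

SelectsWithinAntecedent : Model → Set
SelectsWithinAntecedent M = ∀ w X x → sel M w X ≡ just x → X x ≡ true

⇒-elim : ∀ x y → not x ∨ y ≡ true → x ≡ true → y ≡ true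
⇒-elim true y y≡true refl = y≡true

⇔-elim : ∀ x y → (not x ∨ y) ∧ (not y ∨ x) ≡ true → x ≡ y
⇔-elim true  true  _ = refl
⇔-elim false false _ = refl
⇔-elim true  false ()
⇔-elim false true  ()

module Soundness (M : Model) where

  eval-⟦⟧ : ∀ w A → eval (λ C → ⟦ C ⟧ M w) A ≡ ⟦ A ⟧ M w
  eval-⟦⟧ w (atom p) = refl
  eval-⟦⟧ w ⊥'       = refl
  eval-⟦⟧ w (A ⋀ B)  = cong₂ _∧_ (eval-⟦⟧ w A) (eval-⟦⟧ w B)
  eval-⟦⟧ w (A ⋁ B)  = cong₂ _∨_ (eval-⟦⟧ w A) (eval-⟦⟧ w B)
  eval-⟦⟧ w (A ⇒ B)  = cong₂ (λ x y → not x ∨ y) (eval-⟦⟧ w A) (eval-⟦⟧ w B)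
  eval-⟦⟧ w (A ▷ B)  = refl

  valid-⇔ : ∀ A B → Valid M (A ⇔ B) → ∀ w → ⟦ A ⟧ M w ≡ ⟦ B ⟧ M w
  valid-⇔ A B ⊨A⇔B w = ⇔-elim (⟦ A ⟧ M w) (⟦ B ⟧ M w) (⊨A⇔B w)

  ▷-mono : ∀ (X Y : World M → Bool) m → (∀ x → X x ≡ Y x) → not (maybe′ X true m) ∨ maybe′ Y true m ≡ true
  ▷-mono X Y nothing  X≡Y = refl
  ▷-mono X Y (just x) X≡Y rewrite X≡Y x = ∨-inverseˡ (Y x)

  sound : ∀ {withID A} → (withID ≡ true → SelectsWithinAntecedent M) → Deriv withID A → Valid M A
  sound {A = A} _ (taut ⊨A) w = trans (sym (eval-⟦⟧ w A)) (⊨A (λ C → ⟦ C ⟧ M w))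
  sound success (mp d e) w = ⇒-elim _ _ (sound success d w) (sound success e w)
  sound success (re {φ₀} {φ₁} {ψ₀} {ψ₁} d e) w
    rewrite sel-ext M w (valid-⇔ φ₀ φ₁ (sound success d))
    = ▷-mono (⟦ ψ₀ ⟧ M) (⟦ ψ₁ ⟧ M) (sel M w (⟦ φ₁ ⟧ M)) (valid-⇔ ψ₀ ψ₁ (sound success e))
  sound _ (axCM φ ψ θ) w with sel M w (⟦ φ ⟧ M)
  ... | nothing = refl
  ... | just x  = ∨-inverseˡ (⟦ ψ ⟧ M x ∧ ⟦ θ ⟧ M x)
  sound _ (axCC φ ψ θ) w with sel M w (⟦ φ ⟧ M)
  ... | nothing = refl
  ... | just x  = ∨-inverseˡ (⟦ ψ ⟧ M x ∧ ⟦ θ ⟧ M x)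
  sound _ (axCN φ) w with sel M w (⟦ φ ⟧ M)
  ... | nothing = refl
  ... | just x  = refl
  sound _ (axCEM φ ψ) w with sel M w (⟦ φ ⟧ M)
  ... | nothing = refl
  ... | just x with ⟦ ψ ⟧ M x
  ...   | true  = refl
  ...   | false = refl
  sound success (axID withID≡true φ) w with sel M w (⟦ φ ⟧ M) in selected
  ... | nothing = refl
  ... | just x  = success withID≡true w (⟦ φ ⟧ M) x selected

open Soundness using (sound)

disjunctive-syllogism : ∀ {withID} A B → Deriv withID (A ⋁ B) → Deriv withID (¬' B ⇒ A)
disjunctive-syllogism A B = mp (taut (λ v → tautology (eval v A) (eval v B)))
  where
  tautology : ∀ x y → not (x ∨ y) ∨ (not (not y ∨ false) ∨ x) ≡ true
  tautology true  true  = refl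
  tautology true  false = refl
  tautology false true  = refl
  tautology false false = refl

Mentions : ℕ → Fm → Set
Mentions p (atom q) = p ≡ q
Mentions p ⊥'       = ⊥
Mentions p (A ⋀ B)  = Mentions p A ⊎ Mentions p B
Mentions p (A ⋁ B)  = Mentions p A ⊎ Mentions p B
Mentions p (A ⇒ B)  = Mentions p A ⊎ Mentions p B
Mentions p (A ▷ B)  = Mentions p A ⊎ Mentions p B

mentions⇒occurs : ∀ {p} A → Mentions p A → Occ pos p A ⊎ Occ neg p A
mentions⇒occurs (atom q) p≡q = inj₁ p≡q
mentions⇒occurs (A ⋀ B) (inj₁ m) = Sum.map inj₁ inj₁ (mentions⇒occurs A m)
mentions⇒occurs (A ⋀ B) (inj₂ m) = Sum.map inj₂ inj₂ (mentions⇒occurs B m)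
mentions⇒occurs (A ⋁ B) (inj₁ m) = Sum.map inj₁ inj₁ (mentions⇒occurs A m)
mentions⇒occurs (A ⋁ B) (inj₂ m) = Sum.map inj₂ inj₂ (mentions⇒occurs B m)
mentions⇒occurs (A ⇒ B) (inj₁ m) = Sum.map inj₁ inj₁ (Sum.swap (mentions⇒occurs A m))
mentions⇒occurs (A ⇒ B) (inj₂ m) = Sum.map inj₂ inj₂ (mentions⇒occurs B m)
mentions⇒occurs (A ▷ B) (inj₁ m) = Sum.map inj₁ inj₁ (Sum.swap (mentions⇒occurs A m))
mentions⇒occurs (A ▷ B) (inj₂ m) = Sum.map inj₂ inj₂ (mentions⇒occurs B m)

free-both⇒¬mentions : ∀ {p} A → Free pos p A → Free neg p A → ¬ Mentions p A
free-both⇒¬mentions A free⁺ free⁻ m = Sum.[ free⁺ , free⁻ ] (mentions⇒occurs A m)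

data Three : Set where
  a b c : Three

valuation : ℕ → Three → Bool
valuation zero    a = true
valuation zero    b = false
valuation zero    c = true
valuation (suc _) a = true
valuation (suc _) b = true
valuation (suc _) c = false

select : Maybe Three → Bool → Bool → Bool → Maybe Three
select nothing  _    _     _    = nothing
select (just t) true false true = just t
select (just t) _    _     _    = nothing

select-diagonal : ∀ t x z → select t x x z ≡ nothing
select-diagonal nothing  _     _ = refl
select-diagonal (just t) true  _ = refl
select-diagonal (just t) false _ = refl

select-just : ∀ t x y z {s} → select t x y z ≡ just s → t ≡ just s × x ≡ true × z ≡ true
select-just (just t) true false true t≡s = cong just (just-injective t≡s) , refl , refl

M : Maybe Three → Model
M t = record
  { World   = Three
  ; val     = valuation
  ; sel     = λ _ X → select t (X a) (X b) (X c)
  ; sel-ext = λ _ X≡Y → cong₂ (λ x (y , z) → select t x y z) (X≡Y a) (cong₂ _,_ (X≡Y b) (X≡Y c))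
  }

M-selectsWithin : ∀ t → t ≢ b → SelectsWithinAntecedent (M (just t))
M-selectsWithin t t≢b _ X s selected with select-just (just t) (X a) (X b) (X c) selected
M-selectsWithin a _   _ X .a _ | refl , Xa , _  = Xa
M-selectsWithin b b≢b _ X .b _ | refl , _  , _  = ⊥-elim (b≢b refl)
M-selectsWithin c _   _ X .c _ | refl , _  , Xc = Xc

▷-vacuous : ∀ t A B → ⟦ A ⟧ (M t) a ≡ ⟦ A ⟧ (M t) b → Valid (M t) (A ▷ B)
▷-vacuous t A B a≡b w rewrite a≡b | select-diagonal t (⟦ A ⟧ (M t) b) (⟦ A ⟧ (M t) c) = refl

p-free-a≡b : ∀ A → ¬ Mentions 0 A → ⟦ A ⟧ (M nothing) a ≡ ⟦ A ⟧ (M nothing) b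
p-free-a≡b (atom zero)    ¬m = ⊥-elim (¬m refl)
p-free-a≡b (atom (suc _)) ¬m = refl
p-free-a≡b ⊥'      ¬m = refl
p-free-a≡b (A ⋀ B) ¬m = cong₂ _∧_ (p-free-a≡b A (¬m ∘ inj₁)) (p-free-a≡b B (¬m ∘ inj₂))
p-free-a≡b (A ⋁ B) ¬m = cong₂ _∨_ (p-free-a≡b A (¬m ∘ inj₁)) (p-free-a≡b B (¬m ∘ inj₂))
p-free-a≡b (A ⇒ B) ¬m =
  cong₂ (λ x y → not x ∨ y) (p-free-a≡b A (¬m ∘ inj₁)) (p-free-a≡b B (¬m ∘ inj₂))
p-free-a≡b (A ▷ B) ¬m = refl

p-free-invariant : ∀ t A → ¬ Mentions 0 A → ∀ w → ⟦ A ⟧ (M t) w ≡ ⟦ A ⟧ (M nothing) w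
p-free-invariant t (atom zero)    ¬m w = ⊥-elim (¬m refl)
p-free-invariant t (atom (suc _)) ¬m w = refl
p-free-invariant t ⊥'      ¬m w = refl
p-free-invariant t (A ⋀ B) ¬m w =
  cong₂ _∧_ (p-free-invariant t A (¬m ∘ inj₁) w) (p-free-invariant t B (¬m ∘ inj₂) w)
p-free-invariant t (A ⋁ B) ¬m w =
  cong₂ _∨_ (p-free-invariant t A (¬m ∘ inj₁) w) (p-free-invariant t B (¬m ∘ inj₂) w)
p-free-invariant t (A ⇒ B) ¬m w =
  cong₂ (λ x y → not x ∨ y) (p-free-invariant t A (¬m ∘ inj₁) w) (p-free-invariant t B (¬m ∘ inj₂) w)
p-free-invariant t (A ▷ B) ¬m w = ▷-vacuous t A B a≡b w
  where
  a≡b : ⟦ A ⟧ (M t) a ≡ ⟦ A ⟧ (M t) b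
  a≡b = trans (p-free-invariant t A (¬m ∘ inj₁) a)
          (trans (p-free-a≡b A (¬m ∘ inj₁)) (sym (p-free-invariant t A (¬m ∘ inj₁) b)))

p q : Fm
p = atom 0
q = atom 1

false≢true : false ≢ true
false≢true ()

¬ULIP : ∀ withID → ¬ ULIP (Deriv withID)
¬ULIP withID ulip with ulip (p ▷ q) 0 neg
... | ∀p , _ , ∀p-free⁻ , _ , ∀p-vars , _ , ⊢∀p⇒φ , ∀p-greatest , _ =
  false≢true (⇒-elim (⟦ ∀p ⟧ (M (just c)) a) false (sound-in c (λ ()) ⊢∀p⇒φ a) ∀p-at-a-in-Mc)
  where
  ψ : Fm
  ψ = ¬' (p ▷ ¬' q)

  ψ-free⁻ : Free neg 0 ψ
  ψ-free⁻ (inj₁ (inj₁ ()))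
  ψ-free⁻ (inj₁ (inj₂ (inj₁ ())))
  ψ-free⁻ (inj₁ (inj₂ (inj₂ ())))
  ψ-free⁻ (inj₂ ())

  ∀p-free⁺ : Free pos 0 ∀p
  ∀p-free⁺ occ with ∀p-vars pos 0 occ
  ... | inj₁ ()
  ... | inj₂ ()

  ¬mentions : ¬ Mentions 0 ∀p
  ¬mentions = free-both⇒¬mentions ∀p ∀p-free⁺ ∀p-free⁻

  ⊢ψ⇒∀p : Deriv withID (ψ ⇒ ∀p)
  ⊢ψ⇒∀p = ∀p-greatest ψ ψ-free⁻ (disjunctive-syllogism (p ▷ q) (p ▷ ¬' q) (axCEM p q))

  sound-in : ∀ t → t ≢ b → ∀ {A} → Deriv withID A → Valid (M (just t)) A
  sound-in t t≢b = sound (M (just t)) (λ _ → M-selectsWithin t t≢b)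

  -- ψ holds at a in M (just a), and φ fails at a in M (just c), by computation.
  ∀p-at-a-in-Ma : ⟦ ∀p ⟧ (M (just a)) a ≡ true
  ∀p-at-a-in-Ma = sound-in a (λ ()) ⊢ψ⇒∀p a

  ∀p-at-a-in-Mc : ⟦ ∀p ⟧ (M (just c)) a ≡ true
  ∀p-at-a-in-Mc = trans (p-free-invariant (just c) ∀p ¬mentions a)
    (trans (sym (p-free-invariant (just a) ∀p ¬mentions a)) ∀p-at-a-in-Ma)

mainTheorem10 : ¬ ULIP CKCEM × ¬ ULIP CKCEMID
mainTheorem10 = ¬ULIP false , ¬ULIP true
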